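{- The formula $(p\land q)\rightarrow p$ is provable in minimal propositional logic, but its implicational translation $((p \rightarrow (q \rightarrow \bot)) \rightarrow \bot)\rightarrow p$ is not a theorem of $\text{LM}_{\rightarrow}$ or of $\text{NM}_{\rightarrow}$. Consequently $\text{LM}_{\rightarrow}$ and $\text{NM}_{\rightarrow}$ are not complete with respect to minimal propositional logic.
   Context: Minimal propositional logic is intuitionistic propositional logic with the connectives $\land,\lor,\rightarrow,\bot$ but without the principle of explosion ($\bot\vdash p$). A natural deduction system for it is Prawitz's system with rules $\land I$, $\land E$, $\lor I$, $\lor E$, $\rightarrow I$, $\rightarrow E$. $\text{LM}_{\rightarrow}$ (Gordeev–Haeusler) is the purely implicational subsystem of Hudelmaier's sequent calculus LG: it keeps the axiom $\Gamma,p\Rightarrow p$ and only the implicational rules, and drops the axiom $\Gamma,\bot\Rightarrow p$ as well as the rules $GI1\land$, $GI2\land$, $GI1\lor$, $GI2\lor$, $GE\land$, $GE\lor$, $GE\rightarrow\land$, $GE\rightarrow\lor$. $\text{NM}_{\rightarrow}$ is the implicational fragment of Prawitz's natural deduction for minimal logic (rules $\rightarrow I$, $\rightarrow E$, plus some repetition rules), omitting $\land I$, $\land E$, $\lor I$, $\lor E$. Both systems are sound for minimal logic. To make the implicational language functionally complete, $\bot$ is allowed as an atom (e.g. $p\land q$ written as $(p \rightarrow (q \rightarrow \bot))\rightarrow \bot$), but neither system has any axiom or rule specific to $\bot$, so $\bot$ behaves exactly like a propositional variable in derivations. -}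

module Defs where

open import Data.Nat using (ℕ)
open import Data.List using (List; []; _∷_)
open import Data.List.Membership.Propositional using (_∈_)

infixr 5 _⇒′_
infixr 6 _∨′_
infixr 7 _∧′_

data Form : Set where
  var  : ℕ → Form
  ⊥′   : Form
  _∧′_ : Form → Form → Form
  _∨′_ : Form → Form → Form
  _⇒′_ : Form → Form → Form

-- Prawitz natural deduction for minimal logic (no ⊥-rule / explosion).
-- Γ ⊢M A : A is derivable from the open assumptions in Γ.
infix 3 _⊢M_
data _⊢M_ (Γ : List Form) : Form → Set where
  assume : ∀ {A} → A ∈ Γ → Γ ⊢M A
  ∧I  : ∀ {A B} → Γ ⊢M A → Γ ⊢M B → Γ ⊢M A ∧′ B
  ∧E₁ : ∀ {A B} → Γ ⊢M A ∧′ B → Γ ⊢M A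
  ∧E₂ : ∀ {A B} → Γ ⊢M A ∧′ B → Γ ⊢M B
  ∨I₁ : ∀ {A B} → Γ ⊢M A → Γ ⊢M A ∨′ B
  ∨I₂ : ∀ {A B} → Γ ⊢M B → Γ ⊢M A ∨′ B
  ∨E  : ∀ {A B C} → Γ ⊢M A ∨′ B → (A ∷ Γ) ⊢M C → (B ∷ Γ) ⊢M C → Γ ⊢M C
  ⇒I  : ∀ {A B} → (A ∷ Γ) ⊢M B → Γ ⊢M A ⇒′ B
  ⇒E  : ∀ {A B} → Γ ⊢M A ⇒′ B → Γ ⊢M A → Γ ⊢M B

-- Purely implicational language; ⊥ is an atom with no special rules

infixr 5 _⊃_

data IForm : Set where
  ivar : ℕ → IForm
  ibot : IForm
  _⊃_  : IForm → IForm → IForm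

data Atomic : IForm → Set where
  var-atomic : ∀ n → Atomic (ivar n)
  bot-atomic : Atomic ibot

-- LM→ (Gordeev–Haeusler): implicational rules of Hudelmaier's LG.
-- Antecedents are sets, rendered as lists read up to membership: a
-- principal formula "Γ, φ" is any φ ∈ Γ (weakening/contraction implicit).
--   (Ax)    Γ, p ⇒ p                                 (p atomic)
--   (→I)    Γ, α ⇒ β  /  Γ ⇒ α → β
--   (→E_p)  Γ, p, β ⇒ γ  /  Γ, p, p → β ⇒ γ           (p atomic)
--   (→E_→)  Γ, α, β → γ ⇒ β ;  Γ, γ ⇒ δ  /  Γ, (α → β) → γ ⇒ δ
infix 3 _⇒LM_
data _⇒LM_ (Γ : List IForm) : IForm → Set where
  ax    : ∀ {p} → Atomic p → p ∈ Γ → Γ ⇒LM p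
  →I    : ∀ {α β} → (α ∷ Γ) ⇒LM β → Γ ⇒LM α ⊃ β
  →E-p  : ∀ {p β γ} → Atomic p → p ∈ Γ → (p ⊃ β) ∈ Γ →
          (β ∷ Γ) ⇒LM γ → Γ ⇒LM γ
  →E-→  : ∀ {α β γ δ} → ((α ⊃ β) ⊃ γ) ∈ Γ →
          (α ∷ (β ⊃ γ) ∷ Γ) ⇒LM β → (γ ∷ Γ) ⇒LM δ → Γ ⇒LM δ

-- NM→: implicational fragment of Prawitz natural deduction
-- (assumption, →I, →E; repetition rules are admissible and omitted).
infix 3 _⊢NM_
data _⊢NM_ (Γ : List IForm) : IForm → Set where
  assume : ∀ {A} → A ∈ Γ → Γ ⊢NM A
  →I : ∀ {A B} → (A ∷ Γ) ⊢NM B → Γ ⊢NM A ⊃ B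
  →E : ∀ {A B} → Γ ⊢NM A ⊃ B → Γ ⊢NM A → Γ ⊢NM B

conjProj : ℕ → ℕ → Form
conjProj p q = (var p ∧′ var q) ⇒′ var p

iconj : IForm → IForm → IForm
iconj A B = (A ⊃ (B ⊃ ibot)) ⊃ ibot

iconjProj : ℕ → ℕ → IForm
iconjProj p q = iconj (ivar p) (ivar q) ⊃ ivar p

{-# OPTIONS --safe #-}
-- Both implicational calculi are sound for the ordinary truth-table reading
-- of → in which ⊥ is just another atom. Making ⊥ true and every variable
-- false renders the translation of p ∧ q true (its conclusion ⊥ is true)
-- while p is false, so ((p → q → ⊥) → ⊥) → p is refuted and hence
-- underivable; in minimal logic proper, (p ∧ q) → p is immediate by ∧E.
module Submission where

open import Defs
open import Data.Nat using (ℕ)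
open import Data.Empty using (⊥)
open import Data.Unit using (⊤; tt)
open import Data.List using (List; []; _∷_)
open import Data.List.Relation.Unary.All using (All; []; _∷_; lookup)
open import Data.List.Relation.Unary.Any using (here)
open import Data.Product using (_×_; _,_)
open import Function using (const)
open import Relation.Nullary using (¬_)
open import Relation.Binary.PropositionalEquality using (_≢_; refl)

conjProj-derivable : (p q : ℕ) → [] ⊢M conjProj p q
conjProj-derivable p q = ⇒I (∧E₁ (assume (here refl)))

module Semantics (⟦var⟧ : ℕ → Set) (⟦⊥⟧ : Set) where

  ⟦_⟧ : IForm → Set
  ⟦ ivar n ⟧ = ⟦var⟧ n
  ⟦ ibot ⟧   = ⟦⊥⟧
  ⟦ A ⊃ B ⟧  = ⟦ A ⟧ → ⟦ B ⟧

  ⟦_⟧* : List IForm → Set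
  ⟦ Γ ⟧* = All ⟦_⟧ Γ

  ⇒LM-sound : ∀ {Γ A} → Γ ⇒LM A → ⟦ Γ ⟧* → ⟦ A ⟧
  ⇒LM-sound (ax _ p∈Γ)                          ρ = lookup ρ p∈Γ
  ⇒LM-sound (→I d)                              ρ = λ a → ⇒LM-sound d (a ∷ ρ)
  ⇒LM-sound (→E-p _ p∈Γ p⊃β∈Γ d)                ρ =
    ⇒LM-sound d (lookup ρ p⊃β∈Γ (lookup ρ p∈Γ) ∷ ρ)
  ⇒LM-sound (→E-→ {α} {β} {γ} [α⊃β]⊃γ∈Γ d₁ d₂) ρ =
    ⇒LM-sound d₂ (f (λ a → ⇒LM-sound d₁ (a ∷ β⊃γ ∷ ρ)) ∷ ρ)
    where
      f : ⟦ (α ⊃ β) ⊃ γ ⟧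
      f = lookup ρ [α⊃β]⊃γ∈Γ
      -- β → γ is valid because β already gives α → β.
      β⊃γ : ⟦ β ⊃ γ ⟧
      β⊃γ b = f (const b)

  ⊢NM-sound : ∀ {Γ A} → Γ ⊢NM A → ⟦ Γ ⟧* → ⟦ A ⟧
  ⊢NM-sound (assume A∈Γ) ρ = lookup ρ A∈Γ
  ⊢NM-sound (→I d)       ρ = λ a → ⊢NM-sound d (a ∷ ρ)
  ⊢NM-sound (→E d e)     ρ = ⊢NM-sound d ρ (⊢NM-sound e ρ)

open Semantics (const ⊥) ⊤ using (⟦_⟧; ⇒LM-sound; ⊢NM-sound)

iconjProj-refuted : (p q : ℕ) → ¬ ⟦ iconjProj p q ⟧
iconjProj-refuted p q ⟦iconjProj⟧ = ⟦iconjProj⟧ (const tt)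

mainTheorem1 : (p q : ℕ) → p ≢ q →
    ([] ⊢M conjProj p q) × (¬ ([] ⇒LM iconjProj p q)) × (¬ ([] ⊢NM iconjProj p q))
mainTheorem1 p q _ =
    conjProj-derivable p q
  , (λ d → iconjProj-refuted p q (⇒LM-sound d []))
  , (λ d → iconjProj-refuted p q (⊢NM-sound d []))
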